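{- Let $\phi := \Pi.\psi$ and $\phi' := \Pi.\psi'$ be QBFs in prenex CNF with the same prefix $\Pi := Q_1B_1\ldots Q_nB_n$. Then for every $i$ with $0 \le i\le n$: if $\mathit{Abs}(\phi,i) \equiv_t \mathit{Abs}(\phi',i)$, then $\phi \equiv_t \phi'$.
   Context: A QBF in prenex CNF is $\Pi.\psi$ with $\Pi = Q_1B_1\ldots Q_nB_n$ (pairwise disjoint variable blocks, $Q_i\in\{\forall,\exists\}$, $Q_i\ne Q_{i+1}$, $Q_n=\exists$) and CNF $\psi$ over exactly the variables of $\Pi$. The order $\le_\Pi$ orders variables by block index, refined by a fixed total order inside each block. Abstraction: $\mathit{Abs}(\Pi,0):=\Pi$; for $1\le i\le n$, $\mathit{Abs}(\Pi,i) := \exists(B_1\cup\dots\cup B_i)\,Q_{i+1}B_{i+1}\ldots Q_nB_n$ (adjacent blocks with the same quantifier merged), keeping the same total order of variables; $\mathit{Abs}(\Pi.\chi,i) := \mathit{Abs}(\Pi,i).\chi$. Tree semantics: the assignment tree has internal nodes associated with variables in the order $\le_\Pi$, each with two children (the two truth values); root-to-leaf paths are complete assignments. A pre-model (w.r.t. a given prefix) is a subtree containing the root such that every universal internal node in it has both children and every existential internal node exactly one child. A model of $\Pi.\chi$ is a pre-model all of whose root-to-leaf paths satisfy $\chi$. For QBFs with the same prefix, $\Pi.\chi \equiv_t \Pi.\chi'$ means every tree $T$ is a model of $\Pi.\chi$ iff it is a model of $\Pi.\chi'$. -}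

module Defs where

open import Data.Nat using (ℕ; zero; suc; _≟_)
open import Data.Bool using (Bool; true; false)
open import Data.List using (List; []; _∷_; _++_; [_]; length; concatMap; take; drop)
open import Data.List.Membership.Propositional using (_∈_)
open import Data.List.Relation.Unary.All using (All)
open import Data.List.Relation.Unary.Any using (Any)
open import Data.List.Relation.Unary.Unique.Propositional using (Unique)
open import Data.Maybe using (Maybe; just; nothing)
open import Data.Product using (_×_; _,_; proj₁; proj₂)
open import Data.Sum using (_⊎_)
open import Data.Unit using (⊤)
open import Data.Empty using (⊥)
open import Relation.Nullary using (¬_; yes; no)
open import Relation.Binary.PropositionalEquality using (_≡_; _≢_)

data Quant : Set where
  ∀q ∃q : Quant

Var : Set
Var = ℕ

-- a literal is a variable with a polarity (true = positive, false = negated)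
Literal : Set
Literal = Var × Bool

Clause : Set
Clause = List Literal

CNF : Set
CNF = List Clause

-- a block Q B; the list order of B is the fixed total order inside the block
Block : Set
Block = Quant × List Var

Prefix : Set
Prefix = List Block

prefixVars : Prefix → List Var
prefixVars Π = concatMap proj₂ Π

cnfVars : CNF → List Var
cnfVars ψ = concatMap (λ c → concatMap (λ l → proj₁ l ∷ []) c) ψ

Alternating : Prefix → Set
Alternating [] = ⊤
Alternating (_ ∷ []) = ⊤
Alternating ((q , _) ∷ (q' , B) ∷ Π) = (q ≢ q') × Alternating ((q' , B) ∷ Π)

LastExistential : Prefix → Set
LastExistential [] = ⊥
LastExistential ((q , _) ∷ []) = q ≡ ∃q
LastExistential (_ ∷ b ∷ Π) = LastExistential (b ∷ Π)

WellFormedPrefix : Prefix → Set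
WellFormedPrefix Π = Unique (prefixVars Π) × Alternating Π × LastExistential Π

CNFOver : Prefix → CNF → Set
CNFOver Π ψ = (∀ x → x ∈ cnfVars ψ → x ∈ prefixVars Π)
            × (∀ x → x ∈ prefixVars Π → x ∈ cnfVars ψ)

consExists : List Var → Prefix → Prefix
consExists xs ((∃q , ys) ∷ Π) = (∃q , xs ++ ys) ∷ Π
consExists xs Π = (∃q , xs) ∷ Π

-- Abs(Π,0) = Π ; Abs(Π,i) = ∃(B₁ ∪ … ∪ Bᵢ) Q_{i+1}B_{i+1} … QₙBₙ (merged),
-- keeping the same total order of variables
Abs : Prefix → ℕ → Prefix
Abs Π zero = Π
Abs Π (suc i) = consExists (prefixVars (take (suc i) Π)) (drop (suc i) Π)

flatten : Prefix → List (Quant × Var)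
flatten Π = concatMap (λ b → Data.List.map (λ x → (proj₁ b , x)) (proj₂ b)) Π
  where import Data.List

orderVars : Prefix → List Var
orderVars Π = Data.List.map proj₂ (flatten Π)
  where import Data.List

quantAt : List (Quant × Var) → ℕ → Maybe Quant
quantAt [] _ = nothing
quantAt ((q , _) ∷ _) zero = just q
quantAt (_ ∷ vs) (suc k) = quantAt vs k

-- a node of the full assignment tree is the list of truth values chosen
-- along the path from the root (the k-th entry is the value of the k-th
-- variable in the order ≤_Π); the children of xs are xs ++ [ true ] and
-- xs ++ [ false ]
Node : Set
Node = List Bool

Tree : Set₁
Tree = Node → Set

IsSubtree : ℕ → Tree → Set
IsSubtree N T = T []
              × (∀ xs b → T (xs ++ [ b ]) → T xs)
              × (∀ xs → T xs → length xs Data.Nat.≤ N)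
  where import Data.Nat

NodeCond : Maybe Quant → Tree → Node → Set
NodeCond nothing T xs = ⊤
NodeCond (just ∀q) T xs = T (xs ++ [ true ]) × T (xs ++ [ false ])
NodeCond (just ∃q) T xs = (T (xs ++ [ true ]) × ¬ T (xs ++ [ false ]))
                        ⊎ (¬ T (xs ++ [ true ]) × T (xs ++ [ false ]))

PreModel : Prefix → Tree → Set
PreModel Π T = IsSubtree (length (flatten Π)) T
             × (∀ xs → T xs → NodeCond (quantAt (flatten Π) (length xs)) T xs)

valueOf : List Var → List Bool → Var → Bool
valueOf (y ∷ ys) (b ∷ bs) x with x ≟ y
... | yes _ = b
... | no _ = valueOf ys bs x
valueOf _ _ x = false

SatLit : (Var → Bool) → Literal → Set
SatLit σ (x , p) = σ x ≡ p

SatCNF : (Var → Bool) → CNF → Set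
SatCNF σ ψ = All (Any (SatLit σ)) ψ

Model : Prefix → CNF → Tree → Set
Model Π χ T = PreModel Π T
            × (∀ xs → T xs → length xs ≡ length (flatten Π)
                    → SatCNF (valueOf (orderVars Π) xs) χ)

EquivT : Prefix → CNF → CNF → Set₁
EquivT Π χ χ' = ∀ (T : Tree) → (Model Π χ T → Model Π χ' T) × (Model Π χ' T → Model Π χ T)

module Submission where

open import Defs
open import Data.Nat using (ℕ; _≤_)
open import Data.List using (length)

open import Data.Nat using (zero; suc; _<_; s≤s)
open import Data.Nat.Properties using (m≤m+n; m≤n⇒m⊓n≡m; ≮⇒≥; _<?_)
open import Data.Bool using (Bool; true; false)
open import Data.List using (List; []; _∷_; _++_; [_]; map; take; drop)
open import Data.List.Properties
  using (++-assoc; ++-identityʳ; length-++; length-take; take++drop≡id; map-++; map-∘;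
         map-concatMap; concatMap-cong; concatMap-++)
open import Data.Maybe using (just; nothing)
open import Data.Product using (Σ; _×_; _,_; proj₁; proj₂)
open import Data.Sum using (inj₁; inj₂)
open import Data.Unit using (tt)
open import Function using (_∘_; case_of_)
open import Relation.Nullary using (yes; no)
open import Relation.Binary.PropositionalEquality using (_≡_; refl; sym; trans; cong; subst)

-- Let T be a model of Π.ψ and fix a leaf with assignment P ++ R, where P
-- assigns the variables of B₁ … Bᵢ.  Pruning T to the nodes that agree with P gives a
-- model of Abs(Π,i).ψ: above depth |P| every node keeps exactly the child chosen by P,
-- and below it the pruned tree coincides with the subtree of T at P.  By hypothesis it
-- is then a model of Abs(Π,i).ψ', so the chosen leaf satisfies ψ'.

-- Model Π χ depends on Π only through flatten Π; ModelOn abstracts over that list.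
PreModelOn : List (Quant × Var) → Tree → Set
PreModelOn F T = IsSubtree (length F) T × (∀ xs → T xs → NodeCond (quantAt F (length xs)) T xs)

ModelOn : List (Quant × Var) → CNF → Tree → Set
ModelOn F χ T = PreModelOn F T
              × (∀ xs → T xs → length xs ≡ length F → SatCNF (valueOf (map proj₂ F) xs) χ)

ModelsImply : List (Quant × Var) → CNF → CNF → Set₁
ModelsImply F χ χ' = ∀ T → ModelOn F χ T → ModelOn F χ' T

existential : Var → Quant × Var
existential x = ∃q , x

∃-all : List (Quant × Var) → List (Quant × Var)
∃-all = map (existential ∘ proj₂)

prefix-closed : (T : Tree) → (∀ xs b → T (xs ++ [ b ]) → T xs) → ∀ ys zs → T (ys ++ zs) → T ys
prefix-closed T down ys [] t = subst T (++-identityʳ ys) t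
prefix-closed T down ys (z ∷ zs) t =
  down ys z (prefix-closed T down (ys ++ [ z ]) zs (subst T (sym (++-assoc ys [ z ] zs)) t))

exactly-one-child : (T : Tree) (ys : Node) (c : Bool) → T (ys ++ [ c ])
                  → (∀ b → T (ys ++ [ b ]) → b ≡ c) → NodeCond (just ∃q) T ys
exactly-one-child T ys true t unique = inj₁ (t , λ t' → case unique false t' of λ ())
exactly-one-child T ys false t unique = inj₂ ((λ t' → case unique true t' of λ ()) , t)

data Agree : Node → Node → Set where
  []ˡ : ∀ {ys} → Agree [] ys
  []ʳ : ∀ {ps} → Agree ps []
  _∷_ : ∀ b {ps ys} → Agree ps ys → Agree (b ∷ ps) (b ∷ ys)

agree-take : ∀ n xs → Agree (take n xs) xs
agree-take zero xs = []ˡ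
agree-take (suc n) [] = []ˡ
agree-take (suc n) (x ∷ xs) = x ∷ agree-take n xs

agree-++⁻ : ∀ {ps} ys zs → Agree ps (ys ++ zs) → Agree ps ys
agree-++⁻ [] zs _ = []ʳ
agree-++⁻ (y ∷ ys) zs []ˡ = []ˡ
agree-++⁻ (y ∷ ys) zs (.y ∷ a) = y ∷ agree-++⁻ ys zs a

agree-++⁺ : ∀ {ps ys} zs → length ps ≤ length ys → Agree ps ys → Agree ps (ys ++ zs)
agree-++⁺ zs _ []ˡ = []ˡ
agree-++⁺ {[]} zs _ []ʳ = []ˡ
agree-++⁺ zs (s≤s le) (b ∷ a) = b ∷ agree-++⁺ zs le a

agree-next : ∀ {ps ys} → Agree ps ys → length ys < length ps →
  Σ Bool λ c → Σ Node λ rest → ((ys ++ [ c ]) ++ rest ≡ ps) × Agree ps (ys ++ [ c ])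
                               × (∀ b → Agree ps (ys ++ [ b ]) → b ≡ c)
agree-next {p ∷ ps} []ʳ _ = p , ps , refl , p ∷ []ʳ , λ { b (.b ∷ _) → refl }
agree-next (b ∷ a) (s≤s lt) with agree-next a lt
... | c , rest , eq , agrees , unique =
  c , rest , cong (b ∷_) eq , b ∷ agrees , λ { b' (.b ∷ a') → unique b' a' }

restrict : Node → Tree → Tree
restrict P T ys = T ys × Agree P ys

module Abstraction (F₁ F₂ : List (Quant × Var)) where

  vars-∃-all : ∀ F → map proj₂ (∃-all F ++ F₂) ≡ map proj₂ (F ++ F₂)
  vars-∃-all [] = refl
  vars-∃-all (p ∷ F) = cong (proj₂ p ∷_) (vars-∃-all F)

  length-∃-all : ∀ F → length (∃-all F ++ F₂) ≡ length (F ++ F₂)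
  length-∃-all [] = refl
  length-∃-all (p ∷ F) = cong suc (length-∃-all F)

  quantAt-∃-all : ∀ F k → k < length F → quantAt (∃-all F ++ F₂) k ≡ just ∃q
  quantAt-∃-all (p ∷ F) zero _ = refl
  quantAt-∃-all (p ∷ F) (suc k) (s≤s lt) = quantAt-∃-all F k lt

  quantAt-∃-all-beyond : ∀ F k → length F ≤ k → quantAt (∃-all F ++ F₂) k ≡ quantAt (F ++ F₂) k
  quantAt-∃-all-beyond [] k _ = refl
  quantAt-∃-all-beyond (p ∷ F) (suc k) (s≤s le) = quantAt-∃-all-beyond F k le

  nodeCond-restrict : ∀ {T P ys} q → (∀ b → T (ys ++ [ b ]) → Agree P (ys ++ [ b ]))
                    → NodeCond q T ys → NodeCond q (restrict P T) ys
  nodeCond-restrict nothing _ _ = tt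
  nodeCond-restrict (just ∀q) agrees (t , f) = (t , agrees true t) , (f , agrees false f)
  nodeCond-restrict (just ∃q) agrees (inj₁ (t , ¬f)) = inj₁ ((t , agrees true t) , ¬f ∘ proj₁)
  nodeCond-restrict (just ∃q) agrees (inj₂ (¬t , f)) = inj₂ (¬t ∘ proj₁ , (f , agrees false f))

  restrict-preModel : ∀ {T P} → PreModelOn (F₁ ++ F₂) T → T P → length P ≡ length F₁
                    → PreModelOn (∃-all F₁ ++ F₂) (restrict P T)
  restrict-preModel {T} {P} ((root , down , bound) , nodeCond) tP lenP =
    ((root , []ʳ) , (λ ys b (t , a) → down ys b t , agree-++⁻ ys [ b ] a)
                  , (λ ys (t , _) → subst (length ys ≤_) (sym (length-∃-all F₁)) (bound ys t)))
    , nodeCond′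
    where
    nodeCond′ : ∀ ys → restrict P T ys
              → NodeCond (quantAt (∃-all F₁ ++ F₂) (length ys)) (restrict P T) ys
    nodeCond′ ys (t , a) with length ys <? length F₁
    ... | yes lt with agree-next a (subst (length ys <_) (sym lenP) lt)
    ...   | c , rest , eq , agrees , unique =
      subst (λ q → NodeCond q (restrict P T) ys) (sym (quantAt-∃-all F₁ (length ys) lt))
        (exactly-one-child (restrict P T) ys c
          (prefix-closed T down (ys ++ [ c ]) rest (subst T (sym eq) tP) , agrees)
          (λ b → unique b ∘ proj₂))
    nodeCond′ ys (t , a) | no ¬lt =
      subst (λ q → NodeCond q (restrict P T) ys) (sym (quantAt-∃-all-beyond F₁ (length ys) ge))
        (nodeCond-restrict (quantAt (F₁ ++ F₂) (length ys))
          (λ b _ → agree-++⁺ [ b ] (subst (_≤ length ys) (sym lenP) ge) a) (nodeCond ys t))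
      where ge = ≮⇒≥ ¬lt

  restrict-model : ∀ {χ T P} → ModelOn (F₁ ++ F₂) χ T → T P → length P ≡ length F₁
                 → ModelOn (∃-all F₁ ++ F₂) χ (restrict P T)
  restrict-model {χ} (preModel , sat) tP lenP =
    restrict-preModel preModel tP lenP ,
    λ ys (t , _) len → subst (λ vs → SatCNF (valueOf vs ys) χ) (sym (vars-∃-all F₁))
                         (sat ys t (trans len (length-∃-all F₁)))

  abstraction-reflects-implication : ∀ {χ χ'} → ModelsImply (∃-all F₁ ++ F₂) χ χ'
                                   → ModelsImply (F₁ ++ F₂) χ χ'
  abstraction-reflects-implication {χ} {χ'} h T m@(preModel@((_ , down , _) , _) , _) =
    preModel , leaf-sat
    where
    leaf-sat : ∀ xs → T xs → length xs ≡ length (F₁ ++ F₂)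
             → SatCNF (valueOf (map proj₂ (F₁ ++ F₂)) xs) χ'
    leaf-sat xs t len =
      subst (λ vs → SatCNF (valueOf vs xs) χ') (vars-∃-all F₁)
        (proj₂ (h (restrict P T) (restrict-model m tP lenP)) xs (t , agree-take n xs)
          (trans len (sym (length-∃-all F₁))))
      where
      n = length F₁
      P = take n xs
      n≤len : n ≤ length xs
      n≤len = subst (n ≤_) (sym (trans len (length-++ F₁))) (m≤m+n n (length F₂))
      lenP : length P ≡ n
      lenP = trans (length-take n xs) (m≤n⇒m⊓n≡m n≤len)
      tP : T P
      tP = prefix-closed T down P (drop n xs) (subst T (sym (take++drop≡id n xs)) t)

flatten-++ : ∀ Π Π' → flatten (Π ++ Π') ≡ flatten Π ++ flatten Π'
flatten-++ = concatMap-++ _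

flatten-take-drop : ∀ k Π → flatten Π ≡ flatten (take k Π) ++ flatten (drop k Π)
flatten-take-drop k Π = trans (cong flatten (sym (take++drop≡id k Π))) (flatten-++ (take k Π) (drop k Π))

∃-all-flatten : ∀ Π → ∃-all (flatten Π) ≡ map existential (prefixVars Π)
∃-all-flatten Π =
  trans (map-concatMap _ _ Π)
        (trans (concatMap-cong (λ b → sym (map-∘ (proj₂ b))) Π) (sym (map-concatMap _ _ Π)))

flatten-consExists : ∀ xs Π → flatten (consExists xs Π) ≡ map existential xs ++ flatten Π
flatten-consExists xs [] = refl
flatten-consExists xs ((∀q , ys) ∷ Π) = refl
flatten-consExists xs ((∃q , ys) ∷ Π) =
  trans (cong (_++ flatten Π) (map-++ existential xs ys))
        (++-assoc (map existential xs) (map existential ys) (flatten Π))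

flatten-Abs : ∀ k Π → flatten (Abs Π (suc k))
                    ≡ ∃-all (flatten (take (suc k) Π)) ++ flatten (drop (suc k) Π)
flatten-Abs k Π =
  trans (flatten-consExists (prefixVars (take (suc k) Π)) (drop (suc k) Π))
        (cong (_++ flatten (drop (suc k) Π)) (sym (∃-all-flatten (take (suc k) Π))))

lemma1 : (Π : Prefix) (ψ ψ' : CNF)
    → WellFormedPrefix Π → CNFOver Π ψ → CNFOver Π ψ'
    → (i : ℕ) → i ≤ length Π
    → EquivT (Abs Π i) ψ ψ'
    → EquivT Π ψ ψ'
lemma1 Π ψ ψ' _ _ _ zero _ h = h
lemma1 Π ψ ψ' _ _ _ (suc k) _ h T =
  reflect ψ ψ' (λ T → proj₁ (h T)) T , reflect ψ' ψ (λ T → proj₂ (h T)) T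
  where
  open Abstraction (flatten (take (suc k) Π)) (flatten (drop (suc k) Π))
  reflect : ∀ χ χ' → ModelsImply (flatten (Abs Π (suc k))) χ χ' → ModelsImply (flatten Π) χ χ'
  reflect χ χ' = subst (λ F → ModelsImply F χ χ') (sym (flatten-take-drop (suc k) Π))
               ∘ abstraction-reflects-implication
               ∘ subst (λ F → ModelsImply F χ χ') (flatten-Abs k Π)
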